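{- Let $n=p_1p_2p_3$ ($p_i$ distinct primes), $\gcd(n,6)=1$, $n>1000$, $G$ cyclic of order $n$, $\mathrm{ord}(g)=n$. Let $a,b,c$ be integers with $1+c=a+b$ and $1<c<\frac n2<n-b\le n-a<n-1$, such that $S=(g)\cdot(cg)\cdot((n-b)g)\cdot((n-a)g)$ is a reduced minimal zero-sum sequence over $G$ and one of (A2), (A3), (A4) below holds. Let $s=\lfloor b/a\rfloor$ and assume $s\le 9$ and condition (B). If $\lceil\frac nc\rceil<\lceil\frac nb\rceil$, then $\mathrm{ind}(S)=1$.
   Context: Minimal zero-sum sequence: a finite unordered sequence of elements of $G$ whose terms sum to $0$ and no proper nonempty subsequence of which sums to $0$. $S$ is reduced if for every prime $p\mid n$ the sequence $(pg)\cdot(pcg)\cdot(p(n-b)g)\cdot(p(n-a)g)$ is not minimal zero-sum. For a generator $h$ of $G$, write $S=(m_1h)\cdots(m_4h)$ with $m_j\in[1,n]$, $\|S\|_h=(m_1+\cdots+m_4)/n$, and $\mathrm{ind}(S)=\min\{\|S\|_h:\langle h\rangle=G\}$. Conditions (for a suitable labeling of the primes): (A2) $\{\gcd(c,n),\gcd(b,n),\gcd(a,n)\}=\{p_1,p_2,p_1p_2\}$; (A3) $\gcd(c+1,n)=p_1p_2$, $\gcd(b-1,n)=p_1p_3$, $\gcd(a-1,n)=p_2p_3$; (A4) $\gcd(c,n)=p_1p_2$, $\gcd(b,n)=p_1p_3$, $\gcd(a,n)=p_2p_3$. Condition (B): for every integer $t$ with $0\le t\le\lfloor s/2\rfloor-1$,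 the interval $[\frac{(2s-2t-1)n}{2b},\frac{(s-t)n}{b}]$ contains no integer coprime to $n$. -}

module Defs where

open import Data.Nat using (ℕ; zero; suc; _+_; _*_; _∸_; _≤_; _<_; _/_; _%_)
open import Data.Nat.Divisibility using (_∣_)
open import Data.Nat.GCD using (gcd)
open import Data.Nat.Coprimality using (Coprime)
open import Data.Nat.Primality using (Prime)
open import Data.Bool using (Bool; true; false)
open import Data.Fin using (Fin)
open import Data.Fin.Subset using (Subset; Nonempty; ⊤; inside; outside)
open import Data.Vec using (Vec; []; _∷_; map; lookup; sum)
open import Data.Product using (Σ; ∃; _×_; _,_)
open import Data.Sum using (_⊎_)
open import Relation.Binary.PropositionalEquality using (_≡_; _≢_)
open import Relation.Nullary using (¬_)

-- Elements of the cyclic group G ≅ ℤ/nℤ are represented by natural numbers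
-- (residues); equality in G is congruence modulo n.
_≡_[mod_] : ℕ → ℕ → ℕ → Set
x ≡ y [mod zero ] = x ≡ y
x ≡ y [mod suc k ] = x % suc k ≡ y % suc k

selSum : ∀ {k} → Subset k → Vec ℕ k → ℕ
selSum [] [] = 0
selSum (inside ∷ P) (x ∷ xs) = x + selSum P xs
selSum (outside ∷ P) (x ∷ xs) = selSum P xs

MinimalZeroSum : ∀ {k} → ℕ → Vec ℕ k → Set
MinimalZeroSum n xs =
  (n ∣ sum xs) ×
  (∀ (P : Subset _) → Nonempty P → P ≢ ⊤ → ¬ (n ∣ selSum P xs))

scale : ∀ {k} → ℕ → Vec ℕ k → Vec ℕ k
scale p xs = map (p *_) xs

seqS : (n g a b c : ℕ) → Vec ℕ 4
seqS n g a b c = g ∷ (c * g) ∷ ((n ∸ b) * g) ∷ ((n ∸ a) * g) ∷ []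

Reduced : (n g a b c : ℕ) → Set
Reduced n g a b c =
  ∀ p → Prime p → p ∣ n → ¬ MinimalZeroSum n (scale p (seqS n g a b c))

Coeffs : ∀ {k} → (n h : ℕ) → Vec ℕ k → Vec ℕ k → Set
Coeffs n h xs ms =
  ∀ j → (1 ≤ lookup ms j) × (lookup ms j ≤ n) × ((lookup ms j * h) ≡ lookup xs j [mod n ])

-- ind(S) = 1, i.e. min over generators h of ‖S‖_h = (Σ m_j)/n equals 1:
-- the value 1 is attained by some generator, and every generator gives ‖S‖_h ≥ 1.
-- Generators of ℤ/nℤ are the residues h coprime to n.
IndexOne : ∀ {k} → ℕ → Vec ℕ k → Set
IndexOne n xs =
  (∃ λ h → Coprime h n × ∃ λ ms → Coeffs n h xs ms × sum ms ≡ n) ×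
  (∀ h ms → Coprime h n → Coeffs n h xs ms → n ≤ sum ms)

Relabel : (p₁ p₂ p₃ q₁ q₂ q₃ : ℕ) → Set
Relabel p₁ p₂ p₃ q₁ q₂ q₃ =
     (q₁ ≡ p₁ × q₂ ≡ p₂ × q₃ ≡ p₃)
  ⊎ (q₁ ≡ p₁ × q₂ ≡ p₃ × q₃ ≡ p₂)
  ⊎ (q₁ ≡ p₂ × q₂ ≡ p₁ × q₃ ≡ p₃)
  ⊎ (q₁ ≡ p₂ × q₂ ≡ p₃ × q₃ ≡ p₁)
  ⊎ (q₁ ≡ p₃ × q₂ ≡ p₁ × q₃ ≡ p₂)
  ⊎ (q₁ ≡ p₃ × q₂ ≡ p₂ × q₃ ≡ p₁)

_∈₃_ : ℕ → ℕ × ℕ × ℕ → Set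
x ∈₃ (u , v , w) = x ≡ u ⊎ x ≡ v ⊎ x ≡ w

SetEq₃ : ℕ × ℕ × ℕ → ℕ × ℕ × ℕ → Set
SetEq₃ (x , y , z) U =
  (x ∈₃ U × y ∈₃ U × z ∈₃ U) ×
  (∀ t → t ∈₃ U → t ∈₃ (x , y , z))

A2 : (n a b c q₁ q₂ q₃ : ℕ) → Set
A2 n a b c q₁ q₂ q₃ = SetEq₃ (gcd c n , gcd b n , gcd a n) (q₁ , q₂ , q₁ * q₂)

A3 : (n a b c q₁ q₂ q₃ : ℕ) → Set
A3 n a b c q₁ q₂ q₃ =
  (gcd (c + 1) n ≡ q₁ * q₂) × (gcd (b ∸ 1) n ≡ q₁ * q₃) × (gcd (a ∸ 1) n ≡ q₂ * q₃)

A4 : (n a b c q₁ q₂ q₃ : ℕ) → Set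
A4 n a b c q₁ q₂ q₃ =
  (gcd c n ≡ q₁ * q₂) × (gcd b n ≡ q₁ * q₃) × (gcd a n ≡ q₂ * q₃)

-- Floor and ceiling division (divisor 0 is never used below; value 0 then).
⌊_/_⌋ : ℕ → ℕ → ℕ
⌊ m / zero ⌋ = 0
⌊ m / suc d ⌋ = m / suc d

⌈_/_⌉ : ℕ → ℕ → ℕ
⌈ m / zero ⌉ = 0
⌈ m / suc d ⌉ = (m + d) / suc d

-- Condition (B) with s = ⌊b/a⌋: for every integer t with 0 ≤ t ≤ ⌊s/2⌋-1, the
-- interval [(2s-2t-1)n/(2b), (s-t)n/b] contains no integer coprime to n.
-- (The interval lies in the positive reals, so only natural k can lie in it.)
CondB : (n a b : ℕ) → Set
CondB n a b =
  ∀ t → t + 1 ≤ ⌊ ⌊ b / a ⌋ / 2 ⌋ →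
  ∀ k → (2 * ⌊ b / a ⌋ ∸ 2 * t ∸ 1) * n ≤ 2 * b * k →
        b * k ≤ (⌊ b / a ⌋ ∸ t) * n →
        ¬ Coprime k n

module Submission where

-- With L = ⌈n/c⌉ we have n ≤ L·c and, by the
-- hypothesis ⌈n/c⌉ < ⌈n/b⌉, L·b < n.  Any multiplier u coprime to n with n ≤ u·c and
-- u·b < n gives ind(S) = 1: w.r.t. the generator g·u⁻¹, S has coefficients
-- (u, uc − n, n − ub, n − ua), summing to n (`index-one-by-multiplier`).  If L is not
-- coprime to n, a prime x ∣ n divides L, and reducedness at x pins L = x and c·x = n
-- (`reduced⇒pinned`): otherwise x·S would be a minimal zero-sum sequence, because every
-- zero subsum forces n/x to divide one of 1, a−1, a, b−1, b, c+1 (`subsetSum-critical`).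
-- Then L + 1 is a multiplier, unless n ≤ (L+1)·b.  In that last case c = n/x = q·r and
-- the bounds c·x ≤ (1+x)·b, ⌊b/a⌋ = s ≤ 9 and n > 1000 either contradict each other
-- directly or put an integer 2^i·3^j (or 60, 52) coprime to n into one of the windows
-- excluded by Condition (B) (`no-squeeze`, by cases x = 5, 7, 11, ≥ 13).

open import Defs
open import Data.Nat using (ℕ; _+_; _*_; _∸_; _≤_; _<_)
open import Data.Nat.Primality using (Prime)
open import Data.Nat.Coprimality using (Coprime)
open import Data.Product using (∃; _×_)
open import Data.Sum using (_⊎_)
open import Relation.Binary.PropositionalEquality using (_≡_; _≢_)

open import Data.Nat using (zero; suc; _^_; _%_; _/_; NonZero; >-nonZero; >-nonZero⁻¹; _≤ᵇ_; z≤n; s≤s; _<?_; _≤?_)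
open import Data.Nat.Properties
open import Data.Nat.Divisibility
open import Data.Nat.DivMod
open import Data.Nat.Coprimality using (coprime-divisor; coprime-Bézout)
import Data.Nat.Coprimality as Coprimality
open import Data.Nat.GCD using (module Bézout)
open import Data.Nat.Primality using (prime?; prime⇒nonZero; prime⇒irreducible; euclidsLemma; ¬prime[0]; ¬prime[1])
open import Data.Nat.Tactic.RingSolver using (solve-∀)
open import Data.Bool using (T)
open import Data.Unit using (tt)
open import Data.Empty using (⊥; ⊥-elim)
import Data.Fin as Fin
open import Data.Fin.Subset using (Subset; Nonempty; ⊤; ∁; inside; outside)
open import Data.Fin.Subset.Properties using (∉⊥)
open import Data.Vec using (Vec; []; _∷_; map; sum)
open import Data.Product using (_,_; proj₁; proj₂)
open import Data.Sum using (inj₁; inj₂)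
open import Function using (case_of_)
open import Relation.Nullary using (¬_; yes; no)
open import Relation.Nullary.Decidable using (toWitness)
open import Relation.Binary.PropositionalEquality using (refl; sym; trans; cong; cong₂; subst; subst₂; module ≡-Reasoning)

byEval : ∀ {m n} {_ : T (m ≤ᵇ n)} → m ≤ n
byEval {m} {n} {t} = ≤ᵇ⇒≤ m n t

coprime-* : ∀ {x y n} → Coprime x n → Coprime y n → Coprime (x * y) n
coprime-* {x} {y} {n} x⊥n y⊥n {i} (i∣xy , i∣n) = y⊥n (coprime-divisor i⊥x i∣xy , i∣n)
  where
  i⊥x : Coprime i x
  i⊥x (j∣i , j∣x) = x⊥n (j∣x , ∣-trans j∣i i∣n)

prime-coprime : ∀ {q k} → Prime q → ¬ q ∣ k → Coprime q k
prime-coprime q-prime q∤k {i} (i∣q , i∣k) with prime⇒irreducible q-prime i∣q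
... | inj₁ i≡1 = i≡1
... | inj₂ refl = ⊥-elim (q∤k i∣k)

multiple<2n : ∀ {n y} → n ∣ y → 0 < y → y < n + n → y ≡ n
multiple<2n (divides 0 refl) () _
multiple<2n {n} (divides 1 refl) _ _ = +-identityʳ n
multiple<2n {n} (divides (suc (suc q)) refl) _ y<2n =
  ⊥-elim (<⇒≱ y<2n (+-monoʳ-≤ n (m≤m+n n (q * n))))

no-multiple<n : ∀ {n y} → n ∣ y → 0 < y → y < n → ⊥
no-multiple<n n∣y 0<y y<n = <-irrefl (multiple<2n n∣y 0<y (<-≤-trans y<n (m≤m+n _ _))) y<n

positive-factor : ∀ {n x c} .{{_ : NonZero n}} → n ≤ x * c → 0 < x
positive-factor {n} {zero}  n≤0 = ⊥-elim (<⇒≱ (>-nonZero⁻¹ n) n≤0)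
positive-factor {x = suc _} _   = s≤s z≤n

∣-complement : ∀ {m n x y} → x + y ≡ n → m ∣ n → m ∣ x → m ∣ y
∣-complement x+y≡n m∣n m∣x = ∣m+n∣m⇒∣n (subst (_ ∣_) (sym x+y≡n) m∣n) m∣x

record SharedPrime (n u : ℕ) : Set where
  field
    x q r   : ℕ
    x-prime : Prime x
    q-prime : Prime q
    r-prime : Prime r
    split   : n ≡ x * (q * r)
    x∣u     : x ∣ u

coprime-or-shared : ∀ {p₁ p₂ p₃ n} → Prime p₁ → Prime p₂ → Prime p₃ → n ≡ p₁ * p₂ * p₃ →
                    ∀ u → Coprime u n ⊎ SharedPrime n u
coprime-or-shared {p₁} {p₂} {p₃} {n} P₁ P₂ P₃ refl u with p₁ ∣? u | p₂ ∣? u | p₃ ∣? u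
... | yes d | _     | _     = inj₂ (record { x-prime = P₁ ; q-prime = P₂ ; r-prime = P₃ ; split = *-assoc p₁ p₂ p₃ ; x∣u = d })
... | no _  | yes d | _     = inj₂ (record { x-prime = P₂ ; q-prime = P₁ ; r-prime = P₃ ; split = rotate₂ p₁ p₂ p₃ ; x∣u = d })
  where
  rotate₂ : ∀ x y z → x * y * z ≡ y * (x * z)
  rotate₂ = solve-∀
... | no _  | no _  | yes d = inj₂ (record { x-prime = P₃ ; q-prime = P₁ ; r-prime = P₂ ; split = *-comm (p₁ * p₂) p₃ ; x∣u = d })
... | no d₁ | no d₂ | no d₃ =
  inj₁ (Coprimality.sym (coprime-* (coprime-* (prime-coprime P₁ d₁) (prime-coprime P₂ d₂)) (prime-coprime P₃ d₃)))

prime-beyond-3 : ∀ p → Prime p → ¬ 2 ∣ p → ¬ 3 ∣ p → p ≡ 5 ⊎ p ≡ 7 ⊎ p ≡ 11 ⊎ 13 ≤ p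
prime-beyond-3 0  P _ _  = ⊥-elim (¬prime[0] P)
prime-beyond-3 1  P _ _  = ⊥-elim (¬prime[1] P)
prime-beyond-3 2  _ ∤2 _ = ⊥-elim (∤2 ∣-refl)
prime-beyond-3 3  _ _ ∤3 = ⊥-elim (∤3 ∣-refl)
prime-beyond-3 4  _ ∤2 _ = ⊥-elim (∤2 (divides 2 refl))
prime-beyond-3 5  _ _ _  = inj₁ refl
prime-beyond-3 6  _ ∤2 _ = ⊥-elim (∤2 (divides 3 refl))
prime-beyond-3 7  _ _ _  = inj₂ (inj₁ refl)
prime-beyond-3 8  _ ∤2 _ = ⊥-elim (∤2 (divides 4 refl))
prime-beyond-3 9  _ _ ∤3 = ⊥-elim (∤3 (divides 3 refl))
prime-beyond-3 10 _ ∤2 _ = ⊥-elim (∤2 (divides 5 refl))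
prime-beyond-3 11 _ _ _  = inj₂ (inj₂ (inj₁ refl))
prime-beyond-3 12 _ ∤2 _ = ⊥-elim (∤2 (divides 6 refl))
prime-beyond-3 (suc (suc (suc (suc (suc (suc (suc (suc (suc (suc (suc (suc (suc k))))))))))))) _ _ _ =
  inj₂ (inj₂ (inj₂ (m≤m+n 13 k)))

prime-factor-coprime-6 : ∀ {n p} → Coprime n 6 → Prime p → p ∣ n → p ≡ 5 ⊎ p ≡ 7 ⊎ p ≡ 11 ⊎ 13 ≤ p
prime-factor-coprime-6 n⊥6 P p∣n =
  prime-beyond-3 _ P (λ 2∣p → case n⊥6 (∣-trans 2∣p p∣n , divides 3 refl) of λ ())
                     (λ 3∣p → case n⊥6 (∣-trans 3∣p p∣n , divides 2 refl) of λ ())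

prime-factor-≥5 : ∀ {n p} → Coprime n 6 → Prime p → p ∣ n → 5 ≤ p
prime-factor-≥5 n⊥6 P p∣n with prime-factor-coprime-6 n⊥6 P p∣n
... | inj₁ refl = ≤-refl
... | inj₂ (inj₁ refl) = byEval
... | inj₂ (inj₂ (inj₁ refl)) = byEval
... | inj₂ (inj₂ (inj₂ 13≤p)) = ≤-trans byEval 13≤p

two⊥ : ∀ {n} → Coprime n 6 → Coprime 2 n
two⊥ n⊥6 (i∣2 , i∣n) = n⊥6 (i∣n , ∣-trans i∣2 (divides 3 refl))

three⊥ : ∀ {n} → Coprime n 6 → Coprime 3 n
three⊥ n⊥6 (i∣3 , i∣n) = n⊥6 (i∣n , ∣-trans i∣3 (divides 2 refl))

selSum-scale : ∀ {k} (P : Subset k) p (xs : Vec ℕ k) → selSum P (scale p xs) ≡ p * selSum P xs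
selSum-scale []           p []       = sym (*-zeroʳ p)
selSum-scale (inside ∷ P) p (x ∷ xs) = trans (cong (p * x +_) (selSum-scale P p xs)) (sym (*-distribˡ-+ p x _))
selSum-scale (outside ∷ P) p (x ∷ xs) = selSum-scale P p xs

selSum-*ʳ : ∀ {k} (P : Subset k) g (xs : Vec ℕ k) → selSum P (map (_* g) xs) ≡ selSum P xs * g
selSum-*ʳ []            g []       = refl
selSum-*ʳ (inside ∷ P)  g (x ∷ xs) = trans (cong (x * g +_) (selSum-*ʳ P g xs)) (sym (*-distribʳ-+ g x _))
selSum-*ʳ (outside ∷ P) g (x ∷ xs) = selSum-*ʳ P g xs

selSum-∁ : ∀ {k} (P : Subset k) (xs : Vec ℕ k) → selSum P xs + selSum (∁ P) xs ≡ sum xs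
selSum-∁ []            []       = refl
selSum-∁ (inside ∷ P)  (x ∷ xs) = trans (+-assoc x _ _) (cong (x +_) (selSum-∁ P xs))
selSum-∁ (outside ∷ P) (x ∷ xs) = trans (+-comm (selSum P xs) _) (trans (+-assoc x _ _)
                                    (cong (x +_) (trans (+-comm _ (selSum P xs)) (selSum-∁ P xs))))

baseCoeffs : (n a b c : ℕ) → Vec ℕ 4
baseCoeffs n a b c = 1 ∷ c ∷ n ∸ b ∷ n ∸ a ∷ []

seqS-baseCoeffs : ∀ n g a b c → seqS n g a b c ≡ map (_* g) (baseCoeffs n a b c)
seqS-baseCoeffs n g a b c = cong (_∷ (c * g ∷ (n ∸ b) * g ∷ (n ∸ a) * g ∷ [])) (sym (*-identityˡ g))

sum-baseCoeffs : ∀ {n a b c} → 1 + c ≡ a + b → a ≤ n → b ≤ n → sum (baseCoeffs n a b c) ≡ n + n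
sum-baseCoeffs {n} {a} {b} {c} 1+c≡a+b a≤n b≤n = begin
  1 + (c + ((n ∸ b) + ((n ∸ a) + 0)))  ≡⟨ regroup 1 c (n ∸ b) (n ∸ a) ⟩
  (1 + c) + ((n ∸ b) + (n ∸ a))        ≡⟨ cong (_+ ((n ∸ b) + (n ∸ a))) 1+c≡a+b ⟩
  (a + b) + ((n ∸ b) + (n ∸ a))        ≡⟨ pair a b (n ∸ b) (n ∸ a) ⟩
  ((n ∸ b) + b) + ((n ∸ a) + a)        ≡⟨ cong₂ _+_ (m∸n+n≡m b≤n) (m∸n+n≡m a≤n) ⟩
  n + n                                ∎
  where
  open ≡-Reasoning
  regroup : ∀ x y z w → x + (y + (z + (w + 0))) ≡ (x + y) + (z + w)
  regroup = solve-∀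
  pair : ∀ x y z w → (x + y) + (z + w) ≡ (z + y) + (w + x)
  pair = solve-∀

-- A divisor m of n that divides a proper nonempty subsum of the coefficients of S must
-- divide one of the critical values: a number in [1, b], or c, or c + 1.
data Critical (m b c : ℕ) : Set where
  small  : ∀ X → 0 < X → X ≤ b → m ∣ X → Critical m b c
  at-c   : m ∣ c → Critical m b c
  at-c+1 : m ∣ suc c → Critical m b c

minus-plus : ∀ {n k} → k ≤ n → (n ∸ k) + 0 + k ≡ n
minus-plus {n} {k} k≤n = trans (cong (_+ k) (+-identityʳ (n ∸ k))) (m∸n+n≡m k≤n)

one-minus-plus : ∀ {n k} → suc k ≤ n → suc ((n ∸ suc k) + 0) + k ≡ n
one-minus-plus {n} {k} k<n = trans (shift (n ∸ suc k) k) (m∸n+n≡m k<n)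
  where
  shift : ∀ x y → suc (x + 0) + y ≡ x + suc y
  shift = solve-∀

-- The sequence (1, c, n − b, n − a) has subsums ≡ ±1, ±c, ±b, ±a, ±(c+1), ±(b−1), ±(a−1)
-- modulo n.  Since the total is 2n, a subsum and its complementary subsum are divisible
-- by m together, so only singletons and pairs containing position 0 need inspection.
subsetSum-critical : ∀ {m n a b c} → 1 + c ≡ a + b → 2 ≤ a → a ≤ b → b ≤ n → m ∣ n →
  ∀ P → Nonempty P → P ≢ ⊤ → m ∣ selSum P (baseCoeffs n a b c) → Critical m b c
subsetSum-critical {m} {n} {a} {b} {c} 1+c≡a+b (s≤s (s≤s {n = a₂} _)) a≤b@(s≤s {n = b₁} a₁≤b₁) b≤n m∣n =
  critical
  where
  v : Vec ℕ 4
  v = baseCoeffs n a b c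
  a≤n : a ≤ n
  a≤n = ≤-trans a≤b b≤n

  m∣sum : m ∣ sum v
  m∣sum = subst (m ∣_) (sym (sum-baseCoeffs 1+c≡a+b a≤n b≤n)) (∣m∣n⇒∣m+n m∣n m∣n)

  complement : ∀ P → m ∣ selSum P v → m ∣ selSum (∁ P) v
  complement P = ∣-complement (selSum-∁ P v) m∣sum

  via-1 : m ∣ selSum (inside ∷ outside ∷ outside ∷ outside ∷ []) v → Critical m b c
  via-1 d = small 1 (s≤s z≤n) (s≤s z≤n) d
  via-c : m ∣ selSum (outside ∷ inside ∷ outside ∷ outside ∷ []) v → Critical m b c
  via-c d = at-c (subst (m ∣_) (+-identityʳ c) d)
  via-b : m ∣ selSum (outside ∷ outside ∷ inside ∷ outside ∷ []) v → Critical m b c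
  via-b d = small b (s≤s z≤n) ≤-refl (∣-complement (minus-plus b≤n) m∣n d)
  via-a : m ∣ selSum (outside ∷ outside ∷ outside ∷ inside ∷ []) v → Critical m b c
  via-a d = small a (s≤s z≤n) a≤b (∣-complement (minus-plus a≤n) m∣n d)
  via-c+1 : m ∣ selSum (inside ∷ inside ∷ outside ∷ outside ∷ []) v → Critical m b c
  via-c+1 d = at-c+1 (subst (m ∣_) (cong suc (+-identityʳ c)) d)
  via-b-1 : m ∣ selSum (inside ∷ outside ∷ inside ∷ outside ∷ []) v → Critical m b c
  via-b-1 d = small b₁ (≤-trans (s≤s z≤n) a₁≤b₁) (n≤1+n b₁) (∣-complement (one-minus-plus b≤n) m∣n d)
  via-a-1 : m ∣ selSum (inside ∷ outside ∷ outside ∷ inside ∷ []) v → Critical m b c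
  via-a-1 d = small (suc a₂) (s≤s z≤n) (≤-trans (n≤1+n _) a≤b) (∣-complement (one-minus-plus a≤n) m∣n d)

  critical : ∀ P → Nonempty P → P ≢ ⊤ → m ∣ selSum P v → Critical m b c
  critical (outside ∷ outside ∷ outside ∷ outside ∷ []) (_ , i∈∅) _ _ = ⊥-elim (∉⊥ i∈∅)
  critical (inside ∷ inside ∷ inside ∷ inside ∷ []) _ P≢⊤ _ = ⊥-elim (P≢⊤ refl)
  critical (inside ∷ outside ∷ outside ∷ outside ∷ []) _ _ d = via-1 d
  critical (outside ∷ inside ∷ outside ∷ outside ∷ []) _ _ d = via-c d
  critical (outside ∷ outside ∷ inside ∷ outside ∷ []) _ _ d = via-b d
  critical (outside ∷ outside ∷ outside ∷ inside ∷ []) _ _ d = via-a d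
  critical (inside ∷ inside ∷ outside ∷ outside ∷ []) _ _ d = via-c+1 d
  critical (inside ∷ outside ∷ inside ∷ outside ∷ []) _ _ d = via-b-1 d
  critical (inside ∷ outside ∷ outside ∷ inside ∷ []) _ _ d = via-a-1 d
  critical P@(outside ∷ inside ∷ inside ∷ inside ∷ []) _ _ d = via-1 (complement P d)
  critical P@(inside ∷ outside ∷ inside ∷ inside ∷ []) _ _ d = via-c (complement P d)
  critical P@(inside ∷ inside ∷ outside ∷ inside ∷ []) _ _ d = via-b (complement P d)
  critical P@(inside ∷ inside ∷ inside ∷ outside ∷ []) _ _ d = via-a (complement P d)
  critical P@(outside ∷ outside ∷ inside ∷ inside ∷ []) _ _ d = via-c+1 (complement P d)
  critical P@(outside ∷ inside ∷ outside ∷ inside ∷ []) _ _ d = via-b-1 (complement P d)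
  critical P@(outside ∷ inside ∷ inside ∷ outside ∷ []) _ _ d = via-a-1 (complement P d)

unit-cofactors : ∀ {w p j m} .{{_ : NonZero (p * m)}} → w * p * (j * m) ≡ p * m → w ≡ 1 × j ≡ 1
unit-cofactors {w} {p} {j} {m} eq = m*n≡1⇒m≡1 w j wj≡1 , m*n≡1⇒n≡1 w j wj≡1
  where
  regroup : ∀ w p j m → w * p * (j * m) ≡ (w * j) * (p * m)
  regroup = solve-∀
  wj≡1 : w * j ≡ 1
  wj≡1 = *-cancelʳ-≡ (w * j) 1 (p * m) (trans (sym (regroup w p j m)) (trans eq (sym (*-identityˡ (p * m)))))

-- If p·S
-- is not a minimal zero-sum sequence (S is reduced), then u = p and c·p = n: otherwise
-- every zero subsum of p·S would force m to divide a critical value other than c, and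
-- the size constraints on u rule all of these out.
reduced⇒pinned : ∀ {n p m g a b c u} → Prime p → n ≡ p * m → Coprime g n →
  1 + c ≡ a + b → 2 ≤ a → a ≤ b → n ∣ sum (seqS n g a b c) →
  ¬ MinimalZeroSum n (scale p (seqS n g a b c)) →
  p ∣ u → n ≤ u * c → u * b < n → u ≡ p × c * p ≡ n
reduced⇒pinned {.(p * m)} {p} {m} {g} {a} {b} {c} {u} p-prime refl g⊥n 1+c≡a+b a≥2 a≤b n∣S notMinimal
               (divides w u≡wp) n≤uc ub<n =
  case m ∣? c of λ where
    (no m∤c)  → ⊥-elim (notMinimal (n∣pS , noZeroSubsum m∤c))
    (yes m∣c) → pinned m∣c
  where
  n : ℕ
  n = p * m
  instance
    p≢0 : NonZero p
    p≢0 = prime⇒nonZero p-prime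
    n≢0 : NonZero n
    n≢0 = >-nonZero (≤-<-trans z≤n ub<n)
    m≢0 : NonZero m
    m≢0 = m*n≢0⇒n≢0 p
    u≢0 : NonZero u
    u≢0 = >-nonZero (positive-factor n≤uc)

  v : Vec ℕ 4
  v = baseCoeffs n a b c
  b≤n : b ≤ n
  b≤n = ≤-trans (m≤n*m b u) (<⇒≤ ub<n)
  m∣n : m ∣ n
  m∣n = divides p refl

  u[c+1]<2n : u * suc c < n + n
  u[c+1]<2n = begin-strict
    u * suc c   ≤⟨ *-monoʳ-≤ u (subst (_≤ b + b) (sym 1+c≡a+b) (+-monoˡ-≤ b a≤b)) ⟩
    u * (b + b) ≡⟨ *-distribˡ-+ u b b ⟩
    u * b + u * b <⟨ +-mono-< ub<n ub<n ⟩
    n + n       ∎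
    where open ≤-Reasoning
  uc<u[c+1] : u * c < u * suc c
  uc<u[c+1] = *-monoʳ-< u (n<1+n c)

  lift : ∀ {X} → m ∣ X → n ∣ u * X
  lift {X} m∣X = subst (n ∣_) (sym (trans (cong (_* X) u≡wp) (regroup w p X)))
                       (*-monoʳ-∣ p (∣-trans m∣X (n∣m*n w)))
    where
    regroup : ∀ w p X → w * p * X ≡ p * (w * X)
    regroup = solve-∀

  n∣pS : n ∣ sum (scale p (seqS n g a b c))
  n∣pS = subst (n ∣_) (sym (selSum-scale ⊤ p (seqS n g a b c))) (∣-trans n∣S (n∣m*n p))

  descend : ∀ P → n ∣ selSum P (scale p (seqS n g a b c)) → m ∣ selSum P v
  descend P n∣sub = coprime-divisor m⊥g (subst (m ∣_) (*-comm (selSum P v) g) (*-cancelˡ-∣ p pm∣))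
    where
    m⊥g : Coprime m g
    m⊥g (i∣m , i∣g) = g⊥n (i∣g , ∣-trans i∣m m∣n)
    pm∣ : p * m ∣ p * (selSum P v * g)
    pm∣ = subst (n ∣_) (begin
      selSum P (scale p (seqS n g a b c))    ≡⟨ selSum-scale P p _ ⟩
      p * selSum P (seqS n g a b c)          ≡⟨ cong (λ xs → p * selSum P xs) (seqS-baseCoeffs n g a b c) ⟩
      p * selSum P (map (_* g) v)            ≡⟨ cong (p *_) (selSum-*ʳ P g v) ⟩
      p * (selSum P v * g)                   ∎) n∣sub
      where open ≡-Reasoning

  noZeroSubsum : ¬ m ∣ c → ∀ P → Nonempty P → P ≢ ⊤ → ¬ n ∣ selSum P (scale p (seqS n g a b c))
  noZeroSubsum m∤c P ne P≢⊤ n∣sub with subsetSum-critical 1+c≡a+b a≥2 a≤b b≤n m∣n P ne P≢⊤ (descend P n∣sub)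
  ... | small X 0<X X≤b m∣X = no-multiple<n (lift m∣X) (*-mono-≤ (>-nonZero⁻¹ u) 0<X) (≤-<-trans (*-monoʳ-≤ u X≤b) ub<n)
  ... | at-c m∣c = m∤c m∣c
  ... | at-c+1 m∣c+1 = <-irrefl (sym (multiple<2n (lift m∣c+1) (≤-<-trans z≤n n<u[c+1]) u[c+1]<2n)) n<u[c+1]
    where
    n<u[c+1] : n < u * suc c
    n<u[c+1] = ≤-<-trans n≤uc uc<u[c+1]

  pinned : m ∣ c → u ≡ p × c * p ≡ n
  pinned m∣c@(divides j c≡jm) = u≡p , cp≡n
    where
    uc≡n : u * c ≡ n
    uc≡n = multiple<2n (lift m∣c) (<-≤-trans (>-nonZero⁻¹ n) n≤uc) (<-trans uc<u[c+1] u[c+1]<2n)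
    units : w ≡ 1 × j ≡ 1
    units = unit-cofactors (trans (sym (cong₂ _*_ u≡wp c≡jm)) uc≡n)
    u≡p : u ≡ p
    u≡p = trans u≡wp (trans (cong (_* p) (proj₁ units)) (*-identityˡ p))
    cp≡n : c * p ≡ n
    cp≡n = trans (cong (_* p) (trans c≡jm (trans (cong (_* m) (proj₂ units)) (*-identityˡ m)))) (*-comm m p)

record InverseMod (n u v : ℕ) : Set where
  constructor inverse
  field
    K L      : ℕ
    identity : u * v + K * n ≡ 1 + L * n

module _ {n : ℕ} .{{_ : NonZero n}} where

  ≡+multiple : ∀ x q {y} → y ≡ x + q * n → y % n ≡ x % n
  ≡+multiple x q y≡ = trans (cong (_% n) y≡) ([m+kn]%n≡m%n x q n)

  %-cong-+ : ∀ {a a′ b b′} → a % n ≡ a′ % n → b % n ≡ b′ % n → (a + b) % n ≡ (a′ + b′) % n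
  %-cong-+ {a} {a′} {b} {b′} ea eb = begin
    (a + b) % n               ≡⟨ %-distribˡ-+ a b n ⟩
    (a % n + b % n) % n       ≡⟨ cong₂ (λ x y → (x + y) % n) ea eb ⟩
    (a′ % n + b′ % n) % n     ≡⟨ %-distribˡ-+ a′ b′ n ⟨
    (a′ + b′) % n             ∎
    where open ≡-Reasoning

  -- If v is an inverse of u modulo n and X ≡ Y·u (mod n), then X·(g·v) ≡ Y·g (mod n):
  -- the coefficient of Y·g with respect to the generator g·v is Y·u.
  transfer : ∀ {u v} → InverseMod n u v → ∀ X Y g k l → X + k * n ≡ Y * u + l * n →
             (X * (g * v)) % n ≡ (Y * g) % n
  transfer {u} {v} (inverse K L uv≡1) X Y g k l X≡Yu = begin
    (X * (g * v)) % n                ≡⟨ ≡+multiple (X * (g * v)) (k * (g * v)) (e₁ X k n g v) ⟨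
    ((X + k * n) * (g * v)) % n      ≡⟨ cong (λ z → (z * (g * v)) % n) X≡Yu ⟩
    ((Y * u + l * n) * (g * v)) % n  ≡⟨ ≡+multiple (Y * g * (u * v)) (l * (g * v)) (e₂ Y u l n g v) ⟩
    (Y * g * (u * v)) % n            ≡⟨ ≡+multiple (Y * g * (u * v)) (Y * g * K) (e₃ Y g u v K n) ⟨
    (Y * g * (u * v + K * n)) % n    ≡⟨ cong (λ z → (Y * g * z) % n) uv≡1 ⟩
    (Y * g * (1 + L * n)) % n        ≡⟨ ≡+multiple (Y * g) (Y * g * L) (e₄ Y g L n) ⟩
    (Y * g) % n                      ∎
    where
    open ≡-Reasoning
    e₁ : ∀ X k n g v → (X + k * n) * (g * v) ≡ X * (g * v) + k * (g * v) * n
    e₁ = solve-∀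
    e₂ : ∀ Y u l n g v → (Y * u + l * n) * (g * v) ≡ Y * g * (u * v) + l * (g * v) * n
    e₂ = solve-∀
    e₃ : ∀ Y g u v K n → Y * g * (u * v + K * n) ≡ Y * g * (u * v) + Y * g * K * n
    e₃ = solve-∀
    e₄ : ∀ Y g L n → Y * g * (1 + L * n) ≡ Y * g + Y * g * L * n
    e₄ = solve-∀

inverse-mod : ∀ {n u} .{{_ : NonZero n}} → Coprime u n → ∃ (InverseMod n u)
inverse-mod {suc n₀} {u} u⊥n with coprime-Bézout u⊥n
... | Bézout.+- x y 1+yn≡xu = x , inverse 0 y (trans (+-identityʳ (u * x)) (trans (*-comm u x) (sym 1+yn≡xu)))
... | Bézout.-+ x y 1+xu≡yn = x * n₀ , inverse 1 (y * n₀) (begin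
  u * (x * n₀) + 1 * suc n₀  ≡⟨ e₁ u x n₀ ⟩
  (1 + x * u) * n₀ + 1       ≡⟨ cong (λ z → z * n₀ + 1) 1+xu≡yn ⟩
  y * suc n₀ * n₀ + 1        ≡⟨ e₂ y n₀ ⟩
  1 + y * n₀ * suc n₀        ∎)
  where
  open ≡-Reasoning
  e₁ : ∀ u x n₀ → u * (x * n₀) + 1 * suc n₀ ≡ (1 + x * u) * n₀ + 1
  e₁ = solve-∀
  e₂ : ∀ y n₀ → y * suc n₀ * n₀ + 1 ≡ 1 + y * n₀ * suc n₀
  e₂ = solve-∀

inverse-coprime : ∀ {n u v} → InverseMod n u v → Coprime v n
inverse-coprime {n} {u} {v} (inverse K L uv≡1) {i} (i∣v , i∣n) =
  ∣1⇒≡1 (∣m+n∣m⇒∣n (subst (i ∣_) (trans uv≡1 (+-comm 1 (L * n))) i∣lhs) (∣-trans i∣n (n∣m*n L)))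
  where
  i∣lhs : i ∣ u * v + K * n
  i∣lhs = ∣m∣n⇒∣m+n (∣-trans i∣v (n∣m*n u)) (∣-trans i∣n (n∣m*n K))

coeffs-sum : ∀ {n₀ k h} (xs ms : Vec ℕ k) → Coeffs (suc n₀) h xs ms →
             (sum ms * h) % suc n₀ ≡ sum xs % suc n₀
coeffs-sum []       []       _  = refl
coeffs-sum {n₀} {h = h} (x ∷ xs) (m ∷ ms) co =
  trans (cong (_% suc n₀) (*-distribʳ-+ h m (sum ms)))
        (%-cong-+ {suc n₀} {m * h} {x} {sum ms * h} {sum xs} (proj₂ (proj₂ (co Fin.zero))) (coeffs-sum xs ms (λ j → co (Fin.suc j))))

-- For a zero-sum sequence and any generator h, ‖S‖_h ≥ 1: the coefficient sum is a
-- positive multiple of n.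
norm≥1 : ∀ {n₀ k h} (xs ms : Vec ℕ (suc k)) → suc n₀ ∣ sum xs → Coprime h (suc n₀) →
         Coeffs (suc n₀) h xs ms → suc n₀ ≤ sum ms
norm≥1 {n₀} {h = h} xs ms@(m ∷ ms′) n∣xs h⊥n co =
  ∣⇒≤ {{>-nonZero (≤-trans (proj₁ (co Fin.zero)) (m≤m+n m (sum ms′)))}} n∣ms
  where
  n : ℕ
  n = suc n₀
  n∣msh : n ∣ h * sum ms
  n∣msh = subst (n ∣_) (*-comm (sum ms) h)
            (m%n≡0⇒n∣m (sum ms * h) n (trans (coeffs-sum xs ms co) (n∣m⇒m%n≡0 (sum xs) n n∣xs)))
  n∣ms : n ∣ sum ms
  n∣ms = coprime-divisor (Coprimality.sym h⊥n) n∣msh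

-- Two rearrangements giving the slots c·g and (n − b)·g the form required by `transfer`.
excess-slot : ∀ {n X c u} → n + X ≡ u * c → X + 1 * n ≡ c * u + 0 * n
excess-slot {n} {X} {c} {u} n+X≡uc = trans (e₁ X n) (trans n+X≡uc (e₂ u c n))
  where
  e₁ : ∀ X n → X + 1 * n ≡ n + X
  e₁ = solve-∀
  e₂ : ∀ u c n → u * c ≡ c * u + 0 * n
  e₂ = solve-∀

deficit-slot : ∀ {n B b u X} → u * b + X ≡ n → B + b ≡ n → X + u * n ≡ B * u + 1 * n
deficit-slot {n} {B} {b} {u} {X} ub+X≡n B+b≡n = begin
  X + u * n              ≡⟨ cong (λ z → X + u * z) (sym B+b≡n) ⟩
  X + u * (B + b)        ≡⟨ e X u B b ⟩
  B * u + 1 * (u * b + X) ≡⟨ cong (λ z → B * u + 1 * z) ub+X≡n ⟩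
  B * u + 1 * n          ∎
  where
  open ≡-Reasoning
  e : ∀ X u B b → X + u * (B + b) ≡ B * u + 1 * (u * b + X)
  e = solve-∀

multiplier-sum : ∀ {n a b c u X₁ X₂ X₃} → 1 + c ≡ a + b → n + X₁ ≡ u * c → u * b + X₂ ≡ n → u * a + X₃ ≡ n →
                 u + (X₁ + (X₂ + (X₃ + 0))) ≡ n
multiplier-sum {n} {a} {b} {c} {u} {X₁} {X₂} {X₃} 1+c≡a+b n+X₁ ub+X₂ ua+X₃ =
  +-cancelʳ-≡ (n + (u * b + u * a)) _ _ (begin
    u + (X₁ + (X₂ + (X₃ + 0))) + (n + (u * b + u * a)) ≡⟨ e₁ u X₁ X₂ X₃ n (u * b) (u * a) ⟩
    u + (n + X₁) + (u * b + X₂) + (u * a + X₃)         ≡⟨ cong₂ (λ x y → u + x + y + (u * a + X₃)) n+X₁ ub+X₂ ⟩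
    u + u * c + n + (u * a + X₃)                       ≡⟨ cong (u + u * c + n +_) ua+X₃ ⟩
    u + u * c + n + n                                  ≡⟨ cong (λ z → z + n + n) (*-suc u c) ⟨
    u * (1 + c) + n + n                                ≡⟨ cong (λ z → u * z + n + n) 1+c≡a+b ⟩
    u * (a + b) + n + n                                ≡⟨ e₂ u a b n ⟩
    n + (n + (u * b + u * a))                          ∎)
  where
  open ≡-Reasoning
  e₁ : ∀ u X₁ X₂ X₃ n B A → u + (X₁ + (X₂ + (X₃ + 0))) + (n + (B + A)) ≡ u + (n + X₁) + (B + X₂) + (A + X₃)
  e₁ = solve-∀
  e₂ : ∀ u a b n → u * (a + b) + n + n ≡ n + (n + (u * b + u * a))
  e₂ = solve-∀

-- If u is coprime to n, n ≤ u·c and u·b < n, then with respect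
-- to the generator h = g·u⁻¹ the sequence S has coefficients (u, u·c − n, n − u·b, n − u·a),
-- all in [1, n] and summing to n; together with `norm≥1` this gives ind(S) = 1.
index-one-by-multiplier : ∀ {n g a b c u} → Coprime g n → Coprime u n → 1 + c ≡ a + b → 0 < a → a ≤ b →
  c < n → n ≤ u * c → u * b < n → n ∣ sum (seqS n g a b c) → IndexOne n (seqS n g a b c)
index-one-by-multiplier {zero} _ _ _ _ _ _ _ () _
index-one-by-multiplier {n@(suc n₀)} {g} {a} {b} {c} {u} g⊥n u⊥n 1+c≡a+b 0<a a≤b c<n n≤uc ub<n n∣S =
  representation (inverse-mod u⊥n) ,
  λ h ms h⊥n co → norm≥1 (seqS n g a b c) ms n∣S h⊥n co
  where
  instance
    u≢0 : NonZero u
    u≢0 = >-nonZero (positive-factor n≤uc)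
    b≢0 : NonZero b
    b≢0 = >-nonZero (<-≤-trans 0<a a≤b)

  X₁ X₂ X₃ : ℕ
  X₁ = u * c ∸ n
  X₂ = n ∸ u * b
  X₃ = n ∸ u * a

  ua<n : u * a < n
  ua<n = ≤-<-trans (*-monoʳ-≤ u a≤b) ub<n
  b<n : b < n
  b<n = ≤-<-trans (m≤n*m b u) ub<n
  n+X₁ : n + X₁ ≡ u * c
  n+X₁ = m+[n∸m]≡n n≤uc
  ub+X₂ : u * b + X₂ ≡ n
  ub+X₂ = m+[n∸m]≡n (<⇒≤ ub<n)
  ua+X₃ : u * a + X₃ ≡ n
  ua+X₃ = m+[n∸m]≡n (<⇒≤ ua<n)

  -- u·c lies strictly between n and 2n: it is not n since u ⊥ n and c < n.
  n<uc : n < u * c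
  n<uc = ≤∧≢⇒< n≤uc λ n≡uc → <-irrefl (c≡n n≡uc) c<n
    where
    c≡n : n ≡ u * c → c ≡ n
    c≡n n≡uc = trans (sym (*-identityˡ c)) (trans (cong (_* c) (sym u≡1)) (sym n≡uc))
      where
      u≡1 : u ≡ 1
      u≡1 = u⊥n (∣-refl , divides c (trans n≡uc (*-comm u c)))
  uc<2n : u * c < n + n
  uc<2n = begin-strict
    u * c          ≤⟨ *-monoʳ-≤ u (<⇒≤ (subst (_≤ b + b) (sym 1+c≡a+b) (+-monoˡ-≤ b a≤b))) ⟩
    u * (b + b)    ≡⟨ *-distribˡ-+ u b b ⟩
    u * b + u * b  <⟨ +-mono-< ub<n ub<n ⟩
    n + n          ∎
    where open ≤-Reasoning

  representation : ∃ (InverseMod n u) →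
    ∃ λ h → Coprime h n × ∃ λ ms → Coeffs n h (seqS n g a b c) ms × sum ms ≡ n
  representation (v , inv) =
    g * v , coprime-* g⊥n (inverse-coprime inv) ,
    u ∷ X₁ ∷ X₂ ∷ X₃ ∷ [] , coeffs , multiplier-sum {n} {a} {b} {c} {u} 1+c≡a+b n+X₁ ub+X₂ ua+X₃
    where
    coeffs : Coeffs n (g * v) (seqS n g a b c) (u ∷ X₁ ∷ X₂ ∷ X₃ ∷ [])
    coeffs Fin.zero =
      >-nonZero⁻¹ u , ≤-trans (m≤m*n u b) (<⇒≤ ub<n) ,
      trans (transfer inv u 1 g 0 0 (unit u n)) (cong (_% n) (*-identityˡ g))
      where
      unit : ∀ u n → u + 0 * n ≡ 1 * u + 0 * n
      unit = solve-∀
    coeffs (Fin.suc Fin.zero) =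
      m<n⇒0<n∸m n<uc , <⇒≤ (+-cancelˡ-< n X₁ n (subst (_< n + n) (sym n+X₁) uc<2n)) ,
      transfer inv X₁ c g 1 0 (excess-slot {n} {X₁} {c} {u} n+X₁)
    coeffs (Fin.suc (Fin.suc Fin.zero)) =
      m<n⇒0<n∸m ub<n , m∸n≤m n (u * b) ,
      transfer inv X₂ (n ∸ b) g u 1 (deficit-slot {n} {n ∸ b} {b} {u} ub+X₂ (m∸n+n≡m (<⇒≤ b<n)))
    coeffs (Fin.suc (Fin.suc (Fin.suc Fin.zero))) =
      m<n⇒0<n∸m ua<n , m∸n≤m n (u * a) ,
      transfer inv X₃ (n ∸ a) g u 1 (deficit-slot {n} {n ∸ a} {a} {u} ua+X₃ (m∸n+n≡m (≤-trans a≤b (<⇒≤ b<n))))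

-- Condition (B) for a given value s of ⌊b/a⌋; CondB n a b unfolds to WindowFree ⌊b/a⌋ n b.
WindowFree : (s n b : ℕ) → Set
WindowFree s n b =
  ∀ t → t + 1 ≤ ⌊ s / 2 ⌋ →
  ∀ k → (2 * s ∸ 2 * t ∸ 1) * n ≤ 2 * b * k → b * k ≤ (s ∸ t) * n → ¬ Coprime k n

floor-bounds : ∀ b a .{{_ : NonZero a}} → ⌊ b / a ⌋ * a ≤ b × b < (1 + ⌊ b / a ⌋) * a
floor-bounds b (suc a₁) = m/n*n≤m b (suc a₁) , (begin-strict
  b                                  ≡⟨ m≡m%n+[m/n]*n b (suc a₁) ⟩
  b % suc a₁ + (b / suc a₁) * suc a₁ <⟨ +-monoˡ-< _ (m%n<n b (suc a₁)) ⟩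
  suc a₁ + (b / suc a₁) * suc a₁     ∎)
  where open ≤-Reasoning

-- The final contradiction concerns c·p = n ≤ (1+p)·b together with s = ⌊b/a⌋ and (B).
record Squeeze (p s a b c : ℕ) : Set where
  field
    cp≤[1+p]b   : c * p ≤ (1 + p) * b
    sa≤b        : s * a ≤ b
    b<[1+s]a    : b < (1 + s) * a
    1+c≡a+b     : 1 + c ≡ a + b
    window-free : WindowFree s (c * p) b
open Squeeze

lower-ratio : ∀ {p s a b c} → Squeeze p s a b c → c * s ≤ (1 + s) * b
lower-ratio {p} {s} {a} {b} {c} sq = begin
  c * s         ≤⟨ *-monoˡ-≤ s (n≤1+n c) ⟩
  (1 + c) * s   ≡⟨ cong (_* s) (1+c≡a+b sq) ⟩
  (a + b) * s   ≡⟨ e a b s ⟩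
  s * a + s * b ≤⟨ +-monoˡ-≤ (s * b) (sa≤b sq) ⟩
  b + s * b     ∎
  where
  open ≤-Reasoning
  e : ∀ a b s → (a + b) * s ≡ s * a + s * b
  e = solve-∀

upper-ratio : ∀ {p s a b c} s₀ → s ≤ s₀ → Squeeze p s a b c → (2 + s₀) * b + 1 ≤ (1 + s₀) * (1 + c)
upper-ratio {p} {s} {a} {b} {c} s₀ s≤s₀ sq = begin
  (2 + s₀) * b + 1          ≡⟨ e s₀ b ⟩
  suc b + (1 + s₀) * b      ≤⟨ +-monoˡ-≤ _ (<-≤-trans (b<[1+s]a sq) (*-monoˡ-≤ a (s≤s s≤s₀))) ⟩
  (1 + s₀) * a + (1 + s₀) * b ≡⟨ *-distribˡ-+ (1 + s₀) a b ⟨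
  (1 + s₀) * (a + b)        ≡⟨ cong ((1 + s₀) *_) (1+c≡a+b sq) ⟨
  (1 + s₀) * (1 + c)        ∎
  where
  open ≤-Reasoning
  e : ∀ s b → (2 + s) * b + 1 ≡ suc b + (1 + s) * b
  e = solve-∀

ratio-squeeze : ∀ {κ s p b c} → κ + s + 1 ≡ p → c * p ≤ (1 + p) * b →
                (2 + s) * b + 1 ≤ (1 + s) * (1 + c) → κ * c ≤ (1 + p) * s
ratio-squeeze {κ} {s} {.(κ + s + 1)} {b} {c} refl cp≤ upper =
  +-cancelʳ-≤ R _ _ (subst₂ _≤_ (e₁ κ s c) (e₂ κ s c) (begin
    (2 + s) * (c * p) + (1 + p)     ≤⟨ +-monoˡ-≤ (1 + p) (*-monoʳ-≤ (2 + s) cp≤) ⟩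
    (2 + s) * ((1 + p) * b) + (1 + p) ≡⟨ e₀ s p b ⟩
    (1 + p) * ((2 + s) * b + 1)     ≤⟨ *-monoʳ-≤ (1 + p) upper ⟩
    (1 + p) * ((1 + s) * (1 + c))   ∎))
  where
  open ≤-Reasoning
  p R : ℕ
  p = κ + s + 1
  R = (1 + s) * κ * c + (1 + s) * (2 + s) * c + κ + s + 2
  e₀ : ∀ s p b → (2 + s) * ((1 + p) * b) + (1 + p) ≡ (1 + p) * ((2 + s) * b + 1)
  e₀ = solve-∀
  e₁ : ∀ κ s c → (2 + s) * (c * (κ + s + 1)) + (1 + (κ + s + 1))
               ≡ κ * c + ((1 + s) * κ * c + (1 + s) * (2 + s) * c + κ + s + 2)
  e₁ = solve-∀
  e₂ : ∀ κ s c → (1 + (κ + s + 1)) * ((1 + s) * (1 + c))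
               ≡ (1 + (κ + s + 1)) * s + ((1 + s) * κ * c + (1 + s) * (2 + s) * c + κ + s + 2)
  e₂ = solve-∀

window-lower : ∀ A p k ρ₁ ρ₂ {b c} .{{_ : NonZero ρ₁}} → c * ρ₁ ≤ ρ₂ * b → A * p * ρ₂ ≤ 2 * k * ρ₁ →
               A * (c * p) ≤ 2 * b * k
window-lower A p k ρ₁ ρ₂ {b} {c} ratio numeric = *-cancelˡ-≤ ρ₁ (begin
  ρ₁ * (A * (c * p))  ≡⟨ e₁ ρ₁ A c p ⟩
  A * p * (c * ρ₁)    ≤⟨ *-monoʳ-≤ (A * p) ratio ⟩
  A * p * (ρ₂ * b)    ≡⟨ *-assoc (A * p) ρ₂ b ⟨
  A * p * ρ₂ * b      ≤⟨ *-monoˡ-≤ b numeric ⟩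
  2 * k * ρ₁ * b      ≡⟨ e₂ k ρ₁ b ⟩
  ρ₁ * (2 * b * k)    ∎)
  where
  open ≤-Reasoning
  e₁ : ∀ ρ A c p → ρ * (A * (c * p)) ≡ A * p * (c * ρ)
  e₁ = solve-∀
  e₂ : ∀ k ρ b → 2 * k * ρ * b ≡ ρ * (2 * b * k)
  e₂ = solve-∀

window-upper : ∀ s st k p M c₀ {b c} → k * (1 + s) + M ≡ (2 + s) * st * p → k * s ≤ M * c₀ → c₀ ≤ c →
               (2 + s) * b + 1 ≤ (1 + s) * (1 + c) → b * k ≤ st * (c * p)
window-upper s st k p M c₀ {b} {c} split numeric c₀≤c upper = *-cancelˡ-≤ (2 + s) (+-cancelʳ-≤ k _ _ (begin
  (2 + s) * (b * k) + k          ≡⟨ e₁ s b k ⟩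
  k * ((2 + s) * b + 1)          ≤⟨ *-monoʳ-≤ k upper ⟩
  k * ((1 + s) * (1 + c))        ≡⟨ e₂ k s c ⟩
  k * s + (k + k * (1 + s) * c)  ≤⟨ +-monoˡ-≤ _ (≤-trans numeric (*-monoʳ-≤ M c₀≤c)) ⟩
  M * c + (k + k * (1 + s) * c)  ≡⟨ e₃ M c k s ⟩
  (k * (1 + s) + M) * c + k      ≡⟨ cong (λ z → z * c + k) split ⟩
  (2 + s) * st * p * c + k       ≡⟨ e₄ s st p c k ⟩
  (2 + s) * (st * (c * p)) + k   ∎))
  where
  open ≤-Reasoning
  e₁ : ∀ s b k → (2 + s) * (b * k) + k ≡ k * ((2 + s) * b + 1)
  e₁ = solve-∀
  e₂ : ∀ k s c → k * ((1 + s) * (1 + c)) ≡ k * s + (k + k * (1 + s) * c)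
  e₂ = solve-∀
  e₃ : ∀ M c k s → M * c + (k + k * (1 + s) * c) ≡ (k * (1 + s) + M) * c + k
  e₃ = solve-∀
  e₄ : ∀ s st p c k → (2 + s) * st * p * c + k ≡ (2 + s) * (st * (c * p)) + k
  e₄ = solve-∀

lower-end-p : ∀ A k {p s a b c} .{{_ : NonZero p}} → Squeeze p s a b c → A * p * (1 + p) ≤ 2 * k * p →
              A * (c * p) ≤ 2 * b * k
lower-end-p A k {p} {b = b} {c} sq = window-lower A p k p (1 + p) {b} {c} (cp≤[1+p]b sq)

lower-end-s : ∀ A k {p s a b c} .{{_ : NonZero s}} → Squeeze p s a b c → A * p * (1 + s) ≤ 2 * k * s →
              A * (c * p) ≤ 2 * b * k
lower-end-s A k {p} {s} {b = b} {c} sq = window-lower A p k s (1 + s) {b} {c} (lower-ratio sq)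

upper-end : ∀ st k M c₀ {p s a b c} → Squeeze p s a b c → k * (1 + s) + M ≡ (2 + s) * st * p →
            k * s ≤ M * c₀ → c₀ ≤ c → b * k ≤ st * (c * p)
upper-end st k M c₀ {p} {s} {b = b} {c} sq split numeric c₀≤c =
  window-upper s st k p M c₀ {b} {c} split numeric c₀≤c (upper-ratio s ≤-refl sq)

pow-coprime : ∀ {x n} → Coprime x n → ∀ i → Coprime (x ^ i) n
pow-coprime x⊥n zero    (i∣1 , _) = ∣1⇒≡1 i∣1
pow-coprime x⊥n (suc i) = coprime-* x⊥n (pow-coprime x⊥n i)

smooth-coprime : ∀ {n} → Coprime n 6 → ∀ i j → Coprime (2 ^ i * 3 ^ j) n
smooth-coprime n⊥6 i j = coprime-* (pow-coprime (two⊥ n⊥6) i) (pow-coprime (three⊥ n⊥6) j)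

narrow : ∀ κ s₀ {p s a b c c₀} → κ + s₀ + 1 ≡ p → (1 + p) * s₀ < κ * c₀ → c₀ ≤ c → s ≤ s₀ →
         Squeeze p s a b c → ⊥
narrow κ s₀ p≡ numeric c₀≤c s≤s₀ sq =
  <⇒≱ numeric (≤-trans (*-monoʳ-≤ κ c₀≤c) (ratio-squeeze p≡ (cp≤[1+p]b sq) (upper-ratio s₀ s≤s₀ sq)))

beyond-9 : ∀ k → ¬ 10 + k ≤ 9
beyond-9 k 10+k≤9 = <-irrefl refl (≤-trans (m≤m+n 10 k) 10+k≤9)

-- p = 5 (so c ≥ 201).  For s ≤ 3 the two ratio bounds are incompatible; for 4 ≤ s ≤ 9
-- an explicit k = 2^i·3^j lies in one of the windows excluded by (B).
exclude-5 : ∀ {s a b c} → 201 ≤ c → Coprime (c * 5) 6 → s ≤ 9 → Squeeze 5 s a b c → ⊥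
exclude-5 {0} c≥201 _ _ sq = narrow 1 3 refl byEval c≥201 byEval sq
exclude-5 {1} c≥201 _ _ sq = narrow 1 3 refl byEval c≥201 byEval sq
exclude-5 {2} c≥201 _ _ sq = narrow 1 3 refl byEval c≥201 byEval sq
exclude-5 {3} c≥201 _ _ sq = narrow 1 3 refl byEval c≥201 byEval sq
exclude-5 {4} c≥201 n⊥6 _ sq = window-free sq 1 byEval 16
  (lower-end-p 5 16 sq byEval)
  (upper-end 3 16 10 201 sq refl byEval c≥201) (smooth-coprime n⊥6 4 0)
exclude-5 {5} c≥201 n⊥6 _ sq = window-free sq 0 byEval 27
  (lower-end-p 9 27 sq byEval)
  (upper-end 5 27 13 201 sq refl byEval c≥201) (smooth-coprime n⊥6 0 3)
exclude-5 {6} c≥201 n⊥6 _ sq = window-free sq 1 byEval 27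
  (lower-end-p 9 27 sq byEval)
  (upper-end 5 27 11 201 sq refl byEval c≥201) (smooth-coprime n⊥6 0 3)
exclude-5 {7} c≥201 n⊥6 _ sq = window-free sq 2 byEval 27
  (lower-end-p 9 27 sq byEval)
  (upper-end 5 27 9 201 sq refl byEval c≥201) (smooth-coprime n⊥6 0 3)
exclude-5 {8} c≥201 n⊥6 _ sq = window-free sq 3 byEval 27
  (lower-end-p 9 27 sq byEval)
  (upper-end 5 27 7 201 sq refl byEval c≥201) (smooth-coprime n⊥6 0 3)
exclude-5 {9} c≥201 n⊥6 _ sq = window-free sq 3 byEval 32
  (lower-end-s 11 32 sq byEval)
  (upper-end 6 32 10 201 sq refl byEval c≥201) (smooth-coprime n⊥6 5 0)
exclude-5 {suc (suc (suc (suc (suc (suc (suc (suc (suc (suc k)))))))))} _ _ s≤9 _ = beyond-9 k s≤9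

-- p = 7 (so c ≥ 143).  Narrow for s ≤ 5; windows for 6 ≤ s ≤ 9, where s = 9 needs
-- k = 60 or k = 52 according to whether 5 or 13 is coprime to n.
exclude-7 : ∀ {s a b c} → 143 ≤ c → Coprime (c * 7) 6 → Coprime 5 (c * 7) ⊎ Coprime 13 (c * 7) →
            s ≤ 9 → Squeeze 7 s a b c → ⊥
exclude-7 {0} c≥143 _ _ _ sq = narrow 1 5 refl byEval c≥143 byEval sq
exclude-7 {1} c≥143 _ _ _ sq = narrow 1 5 refl byEval c≥143 byEval sq
exclude-7 {2} c≥143 _ _ _ sq = narrow 1 5 refl byEval c≥143 byEval sq
exclude-7 {3} c≥143 _ _ _ sq = narrow 1 5 refl byEval c≥143 byEval sq
exclude-7 {4} c≥143 _ _ _ sq = narrow 1 5 refl byEval c≥143 byEval sq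
exclude-7 {5} c≥143 _ _ _ sq = narrow 1 5 refl byEval c≥143 byEval sq
exclude-7 {6} c≥143 n⊥6 _ _ sq = window-free sq 1 byEval 36
  (lower-end-p 9 36 sq byEval) (upper-end 5 36 28 143 sq refl byEval c≥143) (smooth-coprime n⊥6 2 2)
exclude-7 {7} c≥143 n⊥6 _ _ sq = window-free sq 2 byEval 36
  (lower-end-p 9 36 sq byEval) (upper-end 5 36 27 143 sq refl byEval c≥143) (smooth-coprime n⊥6 2 2)
exclude-7 {8} c≥143 n⊥6 _ _ sq = window-free sq 3 byEval 36
  (lower-end-p 9 36 sq byEval) (upper-end 5 36 26 143 sq refl byEval c≥143) (smooth-coprime n⊥6 2 2)
exclude-7 {9} c≥143 n⊥6 (inj₁ 5⊥n) _ sq = window-free sq 1 byEval 60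
  (lower-end-p 15 60 sq byEval) (upper-end 8 60 16 143 sq refl byEval c≥143)
  (coprime-* (smooth-coprime n⊥6 2 1) 5⊥n)
exclude-7 {9} c≥143 n⊥6 (inj₂ 13⊥n) _ sq = window-free sq 2 byEval 52
  (lower-end-p 13 52 sq byEval) (upper-end 7 52 19 143 sq refl byEval c≥143)
  (coprime-* (smooth-coprime n⊥6 2 0) 13⊥n)
exclude-7 {suc (suc (suc (suc (suc (suc (suc (suc (suc (suc k)))))))))} _ _ _ s≤9 _ = beyond-9 k s≤9

-- p = 11 (so c ≥ 91).  Narrow for s ≤ 8; the window t = 2 contains k = 81 for s = 9.
exclude-11 : ∀ {s a b c} → 91 ≤ c → Coprime (c * 11) 6 → s ≤ 9 → Squeeze 11 s a b c → ⊥
exclude-11 {s} c≥91 n⊥6 s≤9 sq with s ≤? 8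
... | yes s≤8 = narrow 2 8 refl byEval c≥91 s≤8 sq
... | no s≰8 with ≤-antisym s≤9 (≰⇒> s≰8)
...   | refl = window-free sq 2 byEval 81
  (lower-end-p 13 81 sq byEval) (upper-end 7 81 37 91 sq refl byEval c≥91) (smooth-coprime n⊥6 0 4)

-- For p = κ + 10 with κ ≥ 3 and c ≥ 25, the squeeze κ·c ≤ 9·(1+p) forces n = c·p ≤ 672:
-- it says κ·(c − 9) ≤ 99, whence c ≤ 42 and κ ≤ 6.
large-prime-bound : ∀ {κ p c} → κ + 10 ≡ p → 3 ≤ κ → 25 ≤ c → κ * c ≤ (1 + p) * 9 → c * p ≤ 672
large-prime-bound {κ} {.(κ + 10)} {c} refl κ≥3 c≥25 squeezed = *-mono-≤ c≤42 (+-monoˡ-≤ 10 κ≤6)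
  where
  e : ∀ κ → (1 + (κ + 10)) * 9 ≡ κ * 9 + 99
  e = solve-∀
  excess : κ * (c ∸ 9) ≤ 99
  excess = begin
    κ * (c ∸ 9)    ≡⟨ *-distribˡ-∸ κ c 9 ⟩
    κ * c ∸ κ * 9  ≤⟨ m≤n+o⇒m∸n≤o (κ * c) (κ * 9) (subst (κ * c ≤_) (e κ) squeezed) ⟩
    99             ∎
    where open ≤-Reasoning
  c≤42 : c ≤ 42
  c≤42 = ≤-trans (m≤n+m∸n c 9) (+-monoʳ-≤ 9 (*-cancelˡ-≤ 3 (≤-trans (*-monoˡ-≤ (c ∸ 9) κ≥3) excess)))
  κ≤6 : κ ≤ 6
  κ≤6 = ≮⇒≥ λ 6<κ → <⇒≱ byEval (≤-trans (*-monoˡ-≤ 16 6<κ) (≤-trans (*-monoʳ-≤ κ (∸-monoˡ-≤ 9 c≥25)) excess))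

exclude-large : ∀ {p s a b c} → 13 ≤ p → 25 ≤ c → 1000 < c * p → s ≤ 9 → Squeeze p s a b c → ⊥
exclude-large {p} {c = c} 13≤p c≥25 n>1000 s≤9 sq =
  <⇒≱ n>1000 (≤-trans (large-prime-bound κ+10≡p (∸-monoˡ-≤ 10 13≤p) c≥25 squeezed) byEval)
  where
  κ : ℕ
  κ = p ∸ 10
  κ+10≡p : κ + 10 ≡ p
  κ+10≡p = m∸n+n≡m {p} {10} (≤-trans byEval 13≤p)
  squeezed : κ * c ≤ (1 + p) * 9
  squeezed = ratio-squeeze (trans (+-assoc κ 9 1) κ+10≡p) (cp≤[1+p]b sq) (upper-ratio 9 s≤9 sq)

prime-5 : Prime 5
prime-5 = toWitness {a? = prime? 5} tt

prime-7 : Prime 7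
prime-7 = toWitness {a? = prime? 7} tt

prime-13 : Prime 13
prime-13 = toWitness {a? = prime? 13} tt

prime∣prime : ∀ {x q} → Prime x → Prime q → x ∣ q → x ≡ q
prime∣prime x-prime q-prime x∣q with prime⇒irreducible q-prime x∣q
... | inj₁ refl = ⊥-elim (¬prime[1] x-prime)
... | inj₂ x≡q = x≡q

prime-factor-q·r·7 : ∀ {x q r} → Prime x → Prime q → Prime r → x ∣ q * r * 7 → x ≡ q ⊎ x ≡ r ⊎ x ≡ 7
prime-factor-q·r·7 {q = q} {r} X Q R x∣n with euclidsLemma (q * r) 7 X x∣n
... | inj₂ x∣7 = inj₂ (inj₂ (prime∣prime X prime-7 x∣7))
... | inj₁ x∣qr with euclidsLemma q r X x∣qr
...   | inj₁ x∣q = inj₁ (prime∣prime X Q x∣q)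
...   | inj₂ x∣r = inj₂ (inj₁ (prime∣prime X R x∣r))

-- n = q·r·7 > 1000 is not divisible by both 5 and 13, since 5·13·7 = 455.
five-or-thirteen : ∀ {q r} → Prime q → Prime r → 1000 < q * r * 7 →
                   Coprime 5 (q * r * 7) ⊎ Coprime 13 (q * r * 7)
five-or-thirteen {q} {r} Q R n>1000 with 5 ∣? q * r * 7 | 13 ∣? q * r * 7
... | no 5∤n  | _        = inj₁ (prime-coprime prime-5 5∤n)
... | yes _   | no 13∤n  = inj₂ (prime-coprime prime-13 13∤n)
... | yes 5∣n | yes 13∣n with prime-factor-q·r·7 prime-5 Q R 5∣n | prime-factor-q·r·7 prime-13 Q R 13∣n
...   | inj₁ refl        | inj₂ (inj₁ refl) = ⊥-elim (<⇒≱ n>1000 byEval)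
...   | inj₂ (inj₁ refl) | inj₁ refl        = ⊥-elim (<⇒≱ n>1000 byEval)
...   | inj₁ refl        | inj₁ ()
...   | inj₂ (inj₁ refl) | inj₂ (inj₁ ())
...   | inj₂ (inj₂ ())   | _
...   | _                | inj₂ (inj₂ ())

cofactor-bound : ∀ c₀ {c p} → 1000 < c * p → c₀ * p ≤ 1000 → suc c₀ ≤ c
cofactor-bound c₀ {c} {p} n>1000 c₀p≤1000 with suc c₀ ≤? c
... | yes c₀<c = c₀<c
... | no c₀≮c = ⊥-elim (<⇒≱ n>1000 (≤-trans (*-monoˡ-≤ p (≤-pred (≰⇒> c₀≮c))) c₀p≤1000))

no-squeeze : ∀ {p q r s a b c} → Prime p → Prime q → Prime r → c ≡ q * r → Coprime (c * p) 6 →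
             1000 < c * p → s ≤ 9 → Squeeze p s a b c → ⊥
no-squeeze {p} {q} {r} P Q R refl n⊥6 n>1000 s≤9 sq with prime-factor-coprime-6 n⊥6 P (n∣m*n (q * r))
... | inj₁ refl = exclude-5 (cofactor-bound 200 n>1000 byEval) n⊥6 s≤9 sq
... | inj₂ (inj₁ refl) = exclude-7 (cofactor-bound 142 n>1000 byEval) n⊥6 (five-or-thirteen Q R n>1000) s≤9 sq
... | inj₂ (inj₂ (inj₁ refl)) = exclude-11 (cofactor-bound 90 n>1000 byEval) n⊥6 s≤9 sq
... | inj₂ (inj₂ (inj₂ 13≤p)) = exclude-large 13≤p (*-mono-≤ q≥5 r≥5) n>1000 s≤9 sq
  where
  q≥5 : 5 ≤ q
  q≥5 = prime-factor-≥5 n⊥6 Q (∣-trans (m∣m*n r) (m∣m*n p))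
  r≥5 : 5 ≤ r
  r≥5 = prime-factor-≥5 n⊥6 R (∣-trans (n∣m*n q) (m∣m*n p))

ceil-mul≥ : ∀ n d .{{_ : NonZero d}} → n ≤ ⌈ n / d ⌉ * d
ceil-mul≥ n (suc d₁) = +-cancelʳ-≤ d₁ _ _ (begin
  n + d₁                                 ≡⟨ m≡m%n+[m/n]*n (n + d₁) (suc d₁) ⟩
  (n + d₁) % suc d₁ + ⌈ n / suc d₁ ⌉ * suc d₁ ≤⟨ +-monoˡ-≤ _ (≤-pred (m%n<n (n + d₁) (suc d₁))) ⟩
  d₁ + ⌈ n / suc d₁ ⌉ * suc d₁           ≡⟨ +-comm d₁ _ ⟩
  ⌈ n / suc d₁ ⌉ * suc d₁ + d₁           ∎)
  where open ≤-Reasoning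

below-ceil : ∀ n d L .{{_ : NonZero d}} → L < ⌈ n / d ⌉ → L * d < n
below-ceil n (suc d₁) L L<⌈n/d⌉ with L * suc d₁ <? n
... | yes Ld<n = Ld<n
... | no Ld≮n = ⊥-elim (<⇒≱ L<⌈n/d⌉ (≤-pred (m<n*o⇒m/o<n {n + d₁} {suc L} {suc d₁} n+d₁<[L+1]d)))
  where
  n+d₁<[L+1]d : n + d₁ < suc L * suc d₁
  n+d₁<[L+1]d = subst (n + d₁ <_) (+-comm (L * suc d₁) (suc d₁)) (+-mono-≤-< (≮⇒≥ Ld≮n) (n<1+n d₁))

squeeze : ∀ {n p a b c} .{{_ : NonZero a}} → c * p ≡ n → n ≤ (1 + p) * b → 1 + c ≡ a + b → CondB n a b →
          Squeeze p ⌊ b / a ⌋ a b c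
squeeze {n} {p} {a} {b} {c} cp≡n n≤[1+p]b 1+c≡a+b condB = record
  { cp≤[1+p]b   = subst (_≤ (1 + p) * b) (sym cp≡n) n≤[1+p]b
  ; sa≤b        = proj₁ (floor-bounds b a)
  ; b<[1+s]a    = proj₂ (floor-bounds b a)
  ; 1+c≡a+b     = 1+c≡a+b
  ; window-free = subst (λ m → WindowFree ⌊ b / a ⌋ m b) (sym cp≡n) condB
  }

parameter-order : ∀ {n a b c} → 1 + c ≡ a + b → 2 * c < n → n ∸ b ≤ n ∸ a → n ∸ a < n ∸ 1 →
                  2 ≤ a × a ≤ b × c < n
parameter-order {n} {a} {b} {c} 1+c≡a+b 2c<n n∸b≤n∸a n∸a<n∸1 = a≥2 , a≤b , c<n
  where
  c<n : c < n
  c<n = ≤-<-trans (m≤m+n c (c + 0)) 2c<n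
  a≤n : a ≤ n
  a≤n = ≤-trans (m≤m+n a b) (subst (_≤ n) 1+c≡a+b c<n)
  a≤b : a ≤ b
  a≤b = ≮⇒≥ λ b<a → <⇒≱ (∸-monoʳ-< b<a a≤n) n∸b≤n∸a
  a≥2 : 2 ≤ a
  a≥2 = ≮⇒≥ λ a<2 → <⇒≱ n∸a<n∸1 (∸-monoʳ-≤ n (≤-pred a<2))

module MainArgument
  {p₁ p₂ p₃ n g a b c : ℕ} (P₁ : Prime p₁) (P₂ : Prime p₂) (P₃ : Prime p₃) (n≡p₁p₂p₃ : n ≡ p₁ * p₂ * p₃)
  (n⊥6 : Coprime n 6) (n>1000 : 1000 < n) (g⊥n : Coprime g n) (1+c≡a+b : 1 + c ≡ a + b)
  (a≥2 : 2 ≤ a) (a≤b : a ≤ b) (c<n : c < n) (zero-sum : n ∣ sum (seqS n g a b c))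
  (reduced : Reduced n g a b c) (s≤9 : ⌊ b / a ⌋ ≤ 9) (condB : CondB n a b) where

  private
    instance
      a≢0 : NonZero a
      a≢0 = >-nonZero (≤-trans (s≤s z≤n) a≥2)
      c≢0 : NonZero c
      c≢0 = >-nonZero (≤-pred (≤-trans a≥2 (subst (a ≤_) (sym 1+c≡a+b) (m≤m+n a b))))

  multiplier : ∀ u → Coprime u n → n ≤ u * c → u * b < n → IndexOne n (seqS n g a b c)
  multiplier u u⊥n n≤uc ub<n =
    index-one-by-multiplier g⊥n u⊥n 1+c≡a+b (>-nonZero⁻¹ a) a≤b c<n n≤uc ub<n zero-sum

  pinned : ∀ {u} (sh : SharedPrime n u) → n ≤ u * c → u * b < n → u ≡ SharedPrime.x sh × c * SharedPrime.x sh ≡ n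
  pinned sh = reduced⇒pinned x-prime split g⊥n 1+c≡a+b a≥2 a≤b zero-sum (reduced x x-prime x∣n) x∣u
    where
    open SharedPrime sh
    x∣n : x ∣ n
    x∣n = divides (q * r) (trans split (*-comm x (q * r)))

  -- If L is pinned, then L + 1 (when (L+1)·b < n) is coprime to n: a prime factor of L + 1
  -- would be pinned too, to the same prime c⁻¹·n = L.
  successor-coprime : ∀ {L} → SharedPrime n L → n ≤ L * c → L * b < n → suc L * b < n → Coprime (suc L) n
  successor-coprime {L} sh n≤Lc Lb<n [L+1]b<n with coprime-or-shared P₁ P₂ P₃ n≡p₁p₂p₃ (suc L)
  ... | inj₁ L+1⊥n = L+1⊥n
  ... | inj₂ sh′ = ⊥-elim (<-irrefl (sym L+1≡L) (n<1+n L))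
    where
    pin : L ≡ SharedPrime.x sh × c * SharedPrime.x sh ≡ n
    pin = pinned sh n≤Lc Lb<n
    pin′ : suc L ≡ SharedPrime.x sh′ × c * SharedPrime.x sh′ ≡ n
    pin′ = pinned sh′ (≤-trans n≤Lc (*-monoˡ-≤ c (n≤1+n L))) [L+1]b<n
    x′≡x : SharedPrime.x sh′ ≡ SharedPrime.x sh
    x′≡x = *-cancelˡ-≡ _ _ c (trans (proj₂ pin′) (sym (proj₂ pin)))
    L+1≡L : suc L ≡ L
    L+1≡L = trans (proj₁ pin′) (trans x′≡x (sym (proj₁ pin)))

  no-overshoot : ∀ {L} → SharedPrime n L → n ≤ L * c → L * b < n → n ≤ suc L * b → ⊥
  no-overshoot sh n≤Lc Lb<n n≤[L+1]b =
    no-squeeze x-prime q-prime r-prime c≡qr (subst (λ m → Coprime m 6) (sym cx≡n) n⊥6)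
               (subst (1000 <_) (sym cx≡n) n>1000) s≤9 (squeeze cx≡n n≤[1+x]b 1+c≡a+b condB)
    where
    open SharedPrime sh
    cx≡n : c * x ≡ n
    cx≡n = proj₂ (pinned sh n≤Lc Lb<n)
    n≤[1+x]b : n ≤ (1 + x) * b
    n≤[1+x]b = subst (λ z → n ≤ suc z * b) (proj₁ (pinned sh n≤Lc Lb<n)) n≤[L+1]b
    c≡qr : c ≡ q * r
    c≡qr = *-cancelʳ-≡ c (q * r) x {{prime⇒nonZero x-prime}} (trans cx≡n (trans split (*-comm x (q * r))))

  index-one : ∀ L → n ≤ L * c → L * b < n → IndexOne n (seqS n g a b c)
  index-one L n≤Lc Lb<n with coprime-or-shared P₁ P₂ P₃ n≡p₁p₂p₃ L
  ... | inj₁ L⊥n = multiplier L L⊥n n≤Lc Lb<n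
  ... | inj₂ sh with suc L * b <? n
  ...   | yes [L+1]b<n = multiplier (suc L) (successor-coprime sh n≤Lc Lb<n [L+1]b<n)
                                    (≤-trans n≤Lc (*-monoˡ-≤ c (n≤1+n L))) [L+1]b<n
  ...   | no [L+1]b≮n = ⊥-elim (no-overshoot sh n≤Lc Lb<n (≮⇒≥ [L+1]b≮n))

proposition3p16 : ∀ (p₁ p₂ p₃ n g a b c : ℕ) →
    Prime p₁ → Prime p₂ → Prime p₃ →
    p₁ ≢ p₂ → p₁ ≢ p₃ → p₂ ≢ p₃ →
    n ≡ p₁ * p₂ * p₃ →
    Coprime n 6 →
    1000 < n →
    Coprime g n →
    1 + c ≡ a + b →
    1 < c → 2 * c < n → n < 2 * (n ∸ b) → n ∸ b ≤ n ∸ a → n ∸ a < n ∸ 1 →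
    MinimalZeroSum n (seqS n g a b c) →
    Reduced n g a b c →
    (∃ λ q₁ → ∃ λ q₂ → ∃ λ q₃ → Relabel p₁ p₂ p₃ q₁ q₂ q₃ ×
    (A2 n a b c q₁ q₂ q₃ ⊎ A3 n a b c q₁ q₂ q₃ ⊎ A4 n a b c q₁ q₂ q₃)) →
    ⌊ b / a ⌋ ≤ 9 →
    CondB n a b →
    ⌈ n / c ⌉ < ⌈ n / b ⌉ →
    IndexOne n (seqS n g a b c)
proposition3p16 p₁ p₂ p₃ n g a b c P₁ P₂ P₃ _ _ _ n≡p₁p₂p₃ n⊥6 n>1000 g⊥n 1+c≡a+b c>1 2c<n
                _ n∸b≤n∸a n∸a<n∸1 minimal reduced _ s≤9 condB ⌈n/c⌉<⌈n/b⌉ =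
  index-one ⌈ n / c ⌉ (ceil-mul≥ n c) (below-ceil n b ⌈ n / c ⌉ ⌈n/c⌉<⌈n/b⌉)
  where
  order : 2 ≤ a × a ≤ b × c < n
  order = parameter-order 1+c≡a+b 2c<n n∸b≤n∸a n∸a<n∸1
  a≥2 : 2 ≤ a
  a≥2 = proj₁ order
  a≤b : a ≤ b
  a≤b = proj₁ (proj₂ order)
  instance
    c≢0 : NonZero c
    c≢0 = >-nonZero (<-trans (s≤s z≤n) c>1)
    b≢0 : NonZero b
    b≢0 = >-nonZero (≤-trans (≤-trans (s≤s z≤n) a≥2) a≤b)
  open MainArgument P₁ P₂ P₃ n≡p₁p₂p₃ n⊥6 n>1000 g⊥n 1+c≡a+b a≥2 a≤b (proj₂ (proj₂ order))
                    (proj₁ minimal) reduced s≤9 condB
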